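{- Let $k\geq 2$, $1\leq x\leq k-1$, $n=k+x$, with $(x,n)\notin\{(1,4),(1,6)\}$. Consider a $p$-labeled packing of $k$ copies of $\overrightarrow{C_n}$ and let $q$ be the minimum, over the $p$ labels, of the number of vertices carrying that label. If $q\leq x$, then $p\leq x+2$.
   Context: $\overrightarrow{C_n}$ is the directed cycle (circuit) on $n$ vertices and $\overleftrightarrow{K_n}$ the complete digraph on $n$ vertices. A $p$-labeled packing of $k$ copies of $\overrightarrow{C_n}$ is a map $f$ from $V(\overleftrightarrow{K_n})$ onto a set of exactly $p$ labels together with injections (here bijections) $\sigma_1,\dots,\sigma_k:V(\overrightarrow{C_n})\to V(\overleftrightarrow{K_n})$ such that for $i\neq j$ the induced arc images are disjoint, and for every vertex $v$, $f(\sigma_1(v))=\dots=f(\sigma_k(v))$. Each vertex $v$ of $\overrightarrow{C_n}$ carries the label $f(\sigma_1(v))$. -}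

module Defs where

open import Data.Nat using (ℕ; zero; suc; _+_; _≤_)
open import Data.Fin using (Fin; toℕ)
import Data.Fin as F
open import Data.List using (List; length; filter; allFin)
open import Data.Product using (Σ; ∃; _×_; _,_)
open import Data.Sum using (_⊎_)
open import Data.Empty using (⊥)
open import Relation.Binary.PropositionalEquality using (_≡_; _≢_)
open import Function.Definitions using (Injective; Surjective)

CycArc : (n : ℕ) → Fin n → Fin n → Set
CycArc n u v = (suc (toℕ u) ≡ toℕ v) ⊎ ((suc (toℕ u) ≡ n) × (toℕ v ≡ 0))

CompArc : (n : ℕ) → Fin n → Fin n → Set
CompArc n u v = u ≢ v

record LabeledPacking (n k p : ℕ) : Set where
  field
    f      : Fin n → Fin p
    f-onto : Surjective _≡_ _≡_ f
    σ      : Fin k → Fin n → Fin n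
    σ-inj  : ∀ i → Injective _≡_ _≡_ (σ i)
    σ-arc  : ∀ i u v → CycArc n u v → CompArc n (σ i u) (σ i v)
    disjoint : ∀ i j → i ≢ j → ∀ u v u′ v′ → CycArc n u v → CycArc n u′ v′ →
               (σ i u ≡ σ j u′ × σ i v ≡ σ j v′) → ⊥
    labels-agree : ∀ i j (v : Fin n) → f (σ i v) ≡ f (σ j v)
  labelCount : Fin p → ℕ
  labelCount l = length (filter (λ w → f w F.≟ l) (allFin n))

  IsMinLabelCount : ℕ → Set
  IsMinLabelCount q = (∃ λ l → labelCount l ≡ q) × (∀ l → q ≤ labelCount l)

-- Fix a vertex u whose label a has the minimum number q of vertices, and let R be the set
-- of labels consisting of a and the labels of the k out-neighbours of u, one in each copy.
-- Arc-disjointness makes u and these out-neighbours k + 1 distinct vertices, so at most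
-- x − 1 vertices carry a label outside R, and each such label has at least q vertices:
-- q·|Rᶜ| < x.  Since labels agree across copies, every out-neighbour label of u is, in one
-- fixed copy, the label of the successor of one of the q vertices labelled a: |R| ≤ 1 + q.
-- Either Rᶜ = ∅ or q + |Rᶜ| ≤ 1 + q·|Rᶜ|, so p = |R| + |Rᶜ| ≤ 1 + q + |Rᶜ| ≤ x + 1.
module Submission where

open import Level using (Level; 0ℓ)
open import Data.Nat using (ℕ; zero; suc; _+_; _*_; _∸_; _≤_; _<_; _<?_; z≤n; s≤s)
open import Data.Nat.Properties hiding (_≟_; 0≢1+n; suc-injective)
open import Data.Fin as Fin using (Fin; toℕ; fromℕ<; punchOut; _≟_)
open import Data.Fin.Properties
  using (any?; 0≢1+n; suc-injective; toℕ-fromℕ<; toℕ<n; punchOut-injective; injective⇒≤)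
open import Data.List using (length; filter; tabulate)
open import Data.Product using (∃; _×_; _,_; proj₁; proj₂)
open import Data.Sum using (inj₁; inj₂)
open import Data.Unit using (⊤; tt)
open import Function using (_∘_; id)
open import Function.Definitions using (Injective)
open import Relation.Nullary using (¬_; ¬?; Dec; yes; no; _×-dec_; _⊎-dec_; contradiction)
open import Relation.Unary using (Pred; Decidable; _⊆_; _∪_)
open import Relation.Unary.Properties using (_∪?_; _∩?_; ∁?)
open import Relation.Binary.PropositionalEquality
  using (_≡_; _≢_; refl; sym; trans; cong; subst; module ≡-Reasoning)
open import Algebra.Properties.CommutativeMonoid.Sum +-0-commutativeMonoid
  using (sum; sum-syntax; ∑-comm; ∑-distrib-+; sum-cong-≗)
open import Algebra.Properties.Semiring.Sum +-*-semiring using (*-distribˡ-sum)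

open import Defs

private
  variable
    ℓ ℓ′ : Level
    m n : ℕ
    A B : Set ℓ

indicator : Dec A → ℕ
indicator (yes _) = 1
indicator (no _)  = 0

indicator-mono : (A → B) → (a? : Dec A) (b? : Dec B) → indicator a? ≤ indicator b?
indicator-mono f (yes _) (yes _) = ≤-refl
indicator-mono f (yes a) (no ¬b) = contradiction (f a) ¬b
indicator-mono f (no _)  b?      = z≤n

indicator-× : (a? : Dec A) (b? : Dec B) → indicator (a? ×-dec b?) ≡ indicator a? * indicator b?
indicator-× (yes _) (yes _) = refl
indicator-× (yes _) (no _)  = refl
indicator-× (no _)  _       = refl

indicator-⊎ : (a? : Dec A) (b? : Dec B) → indicator (a? ⊎-dec b?) ≤ indicator a? + indicator b?
indicator-⊎ (yes _) b?      = s≤s z≤n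
indicator-⊎ (no _)  (yes _) = ≤-refl
indicator-⊎ (no _)  (no _)  = z≤n

indicator-¬ : (a? : Dec A) → indicator a? + indicator (¬? a?) ≡ 1
indicator-¬ (yes _) = refl
indicator-¬ (no _)  = refl

∑-mono-≤ : {f g : Fin n → ℕ} → (∀ i → f i ≤ g i) → sum f ≤ sum g
∑-mono-≤ {zero}  f≤g = z≤n
∑-mono-≤ {suc n} f≤g = +-mono-≤ (f≤g Fin.zero) (∑-mono-≤ (f≤g ∘ Fin.suc))

≤-∑ : (f : Fin n → ℕ) (i : Fin n) → f i ≤ sum f
≤-∑ f Fin.zero    = m≤m+n _ _
≤-∑ f (Fin.suc i) = ≤-trans (≤-∑ (f ∘ Fin.suc) i) (m≤n+m _ _)

count : {P : Pred (Fin n) ℓ} → Decidable P → ℕ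
count {n = n} P? = ∑[ i < n ] indicator (P? i)

count-universal : {P : Pred (Fin n) ℓ} (P? : Decidable P) → (∀ i → P i) → count P? ≡ n
count-universal {n = zero}  P? all = refl
count-universal {n = suc n} P? all with P? Fin.zero
... | yes _  = cong suc (count-universal (P? ∘ Fin.suc) (all ∘ Fin.suc))
... | no ¬p0 = contradiction (all Fin.zero) ¬p0

count-empty : {P : Pred (Fin n) ℓ} (P? : Decidable P) → (∀ i → ¬ P i) → count P? ≡ 0
count-empty {n = zero}  P? none = refl
count-empty {n = suc n} P? none with P? Fin.zero
... | yes p0 = contradiction p0 (none Fin.zero)
... | no _   = count-empty (P? ∘ Fin.suc) (none ∘ Fin.suc)

count-pos : {P : Pred (Fin n) ℓ} (P? : Decidable P) {i : Fin n} → P i → 1 ≤ count P?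
count-pos P? {i} Pi with P? i in eq
... | yes _  = ≤-trans (≤-reflexive (cong indicator (sym eq))) (≤-∑ (indicator ∘ P?) i)
... | no ¬Pi = contradiction Pi ¬Pi

count-subsingleton : {P : Pred (Fin n) ℓ} (P? : Decidable P) →
                     (∀ {i j} → P i → P j → i ≡ j) → count P? ≤ 1
count-subsingleton {n = zero}  P? unique = z≤n
count-subsingleton {n = suc n} P? unique with P? Fin.zero
... | yes p0 = ≤-reflexive (cong suc (count-empty (P? ∘ Fin.suc) λ i Pi → 0≢1+n (unique p0 Pi)))
... | no _   = count-subsingleton (P? ∘ Fin.suc) (λ Pi Pj → suc-injective (unique Pi Pj))

count-mono : {P : Pred (Fin n) ℓ} {Q : Pred (Fin n) ℓ′} (P? : Decidable P) (Q? : Decidable Q) →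
             P ⊆ Q → count P? ≤ count Q?
count-mono P? Q? P⊆Q = ∑-mono-≤ λ i → indicator-mono P⊆Q (P? i) (Q? i)

count-cong : {P : Pred (Fin n) ℓ} {Q : Pred (Fin n) ℓ′} (P? : Decidable P) (Q? : Decidable Q) →
             P ⊆ Q → Q ⊆ P → count P? ≡ count Q?
count-cong P? Q? P⊆Q Q⊆P = ≤-antisym (count-mono P? Q? P⊆Q) (count-mono Q? P? Q⊆P)

count-∪ : {P : Pred (Fin n) ℓ} {Q : Pred (Fin n) ℓ′} (P? : Decidable P) (Q? : Decidable Q) →
          count (P? ∪? Q?) ≤ count P? + count Q?
count-∪ P? Q? = ≤-trans (∑-mono-≤ λ i → indicator-⊎ (P? i) (Q? i))
                        (≤-reflexive (∑-distrib-+ (indicator ∘ P?) (indicator ∘ Q?)))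

count-∁ : {P : Pred (Fin n) ℓ} (P? : Decidable P) → count P? + count (∁? P?) ≡ n
count-∁ {n = n} P? = begin
  count P? + count (∁? P?)                               ≡⟨ ∑-distrib-+ (indicator ∘ P?) (indicator ∘ ∁? P?) ⟨
  ∑[ i < n ] (indicator (P? i) + indicator (¬? (P? i))) ≡⟨ sum-cong-≗ (indicator-¬ ∘ P?) ⟩
  ∑[ i < n ] 1                                           ≡⟨ count-universal {P = λ _ → ⊤} (λ _ → yes tt) (λ _ → tt) ⟩
  n                                                      ∎
  where open ≡-Reasoning

count-singleton : (c : Fin n) → count (c ≟_) ≡ 1
count-singleton c = ≤-antisym (count-subsingleton (c ≟_) λ c≡i c≡j → trans (sym c≡i) c≡j)
                              (count-pos (c ≟_) refl)

count-fibres : {P : Pred (Fin n) ℓ} (P? : Decidable P) (h : Fin n → Fin m) →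
               ∑[ l < m ] count (P? ∩? λ v → h v ≟ l) ≡ count P?
count-fibres {n = n} {m = m} P? h = begin
  ∑[ l < m ] ∑[ v < n ] indicator (P? v ×-dec (h v ≟ l))     ≡⟨ ∑-comm (λ l v → indicator (P? v ×-dec (h v ≟ l))) ⟩
  ∑[ v < n ] ∑[ l < m ] indicator (P? v ×-dec (h v ≟ l))     ≡⟨ sum-cong-≗ fibre ⟩
  count P?                                                    ∎
  where
  open ≡-Reasoning
  fibre : ∀ v → ∑[ l < m ] indicator (P? v ×-dec (h v ≟ l)) ≡ indicator (P? v)
  fibre v = begin
    ∑[ l < m ] indicator (P? v ×-dec (h v ≟ l))            ≡⟨ sum-cong-≗ (λ l → indicator-× (P? v) (h v ≟ l)) ⟩
    ∑[ l < m ] (indicator (P? v) * indicator (h v ≟ l))     ≡⟨ *-distribˡ-sum (indicator (P? v)) (indicator ∘ (h v ≟_)) ⟨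
    indicator (P? v) * count (h v ≟_)                       ≡⟨ cong (indicator (P? v) *_) (count-singleton (h v)) ⟩
    indicator (P? v) * 1                                    ≡⟨ *-identityʳ _ ⟩
    indicator (P? v)                                        ∎

count-≤-injective : {P : Pred (Fin m) ℓ} {Q : Pred (Fin n) ℓ′} (P? : Decidable P) (Q? : Decidable Q)
                    {g : Fin m → Fin n} → Injective _≡_ _≡_ g → (∀ {i} → P i → Q (g i)) →
                    count P? ≤ count Q?
count-≤-injective {n = n} P? Q? {g} g-inj P⇒Q = begin
  count P?                                          ≡⟨ count-fibres P? g ⟨
  ∑[ w < n ] count (P? ∩? λ i → g i ≟ w)           ≤⟨ ∑-mono-≤ fibre-≤ ⟩
  count Q?                                          ∎
  where
  open ≤-Reasoning
  fibre-≤ : ∀ w → count (P? ∩? λ i → g i ≟ w) ≤ indicator (Q? w)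
  fibre-≤ w with Q? w
  ... | yes _  = count-subsingleton (P? ∩? λ i → g i ≟ w)
                   λ (_ , gi≡w) (_ , gj≡w) → g-inj (trans gi≡w (sym gj≡w))
  ... | no ¬Qw = ≤-reflexive (count-empty (P? ∩? λ i → g i ≟ w)
                   λ i (Pi , gi≡w) → ¬Qw (subst _ gi≡w (P⇒Q Pi)))

count-≤-surjective : {P : Pred (Fin n) ℓ} {Q : Pred (Fin m) ℓ′} (P? : Decidable P) (Q? : Decidable Q)
                     (h : Fin n → Fin m) → (∀ {l} → Q l → ∃ λ v → P v × h v ≡ l) →
                     count Q? ≤ count P?
count-≤-surjective {m = m} P? Q? h onto = begin
  count Q?                                          ≤⟨ ∑-mono-≤ indicator-≤-fibre ⟩
  ∑[ l < m ] count (P? ∩? λ v → h v ≟ l)           ≡⟨ count-fibres P? h ⟩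
  count P?                                          ∎
  where
  open ≤-Reasoning
  indicator-≤-fibre : ∀ l → indicator (Q? l) ≤ count (P? ∩? λ v → h v ≟ l)
  indicator-≤-fibre l with Q? l
  ... | yes Ql = let v , Pv , hv≡l = onto Ql in count-pos (P? ∩? λ v → h v ≟ l) (Pv , hv≡l)
  ... | no _   = z≤n

*-count-≤-count-preimage : {Q : Pred (Fin m) ℓ} (Q? : Decidable Q) (h : Fin n → Fin m) {q : ℕ} →
                           (∀ {l} → Q l → q ≤ count (λ v → h v ≟ l)) →
                           q * count Q? ≤ count (Q? ∘ h)
*-count-≤-count-preimage {m = m} Q? h {q} large-fibres = begin
  q * count Q?                                      ≡⟨ *-distribˡ-sum q (indicator ∘ Q?) ⟩
  ∑[ l < m ] (q * indicator (Q? l))                 ≤⟨ ∑-mono-≤ fibre-≥ ⟩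
  ∑[ l < m ] count ((Q? ∘ h) ∩? λ v → h v ≟ l)     ≡⟨ count-fibres (Q? ∘ h) h ⟩
  count (Q? ∘ h)                                    ∎
  where
  open ≤-Reasoning
  fibre-≥ : ∀ l → q * indicator (Q? l) ≤ count ((Q? ∘ h) ∩? λ v → h v ≟ l)
  fibre-≥ l with Q? l
  ... | yes Ql = begin
    q * 1                                 ≡⟨ *-identityʳ q ⟩
    q                                     ≤⟨ large-fibres Ql ⟩
    count (λ v → h v ≟ l)                 ≡⟨ count-cong (λ v → h v ≟ l) ((Q? ∘ h) ∩? λ v → h v ≟ l)
                                               (λ hv≡l → subst _ (sym hv≡l) Ql , hv≡l) proj₂ ⟩
    count ((Q? ∘ h) ∩? λ v → h v ≟ l)     ∎
  ... | no _   = ≤-trans (≤-reflexive (*-zeroʳ q)) z≤n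

length-filter-tabulate : {P : Pred A ℓ} (P? : Decidable P) (g : Fin n → A) →
                         length (filter P? (tabulate g)) ≡ count (P? ∘ g)
length-filter-tabulate {n = zero}  P? g = refl
length-filter-tabulate {n = suc n} P? g with P? (g Fin.zero)
... | yes _ = cong suc (length-filter-tabulate P? (g ∘ Fin.suc))
... | no _  = length-filter-tabulate P? (g ∘ Fin.suc)

injective⇒surjective : {g : Fin n → Fin n} → Injective _≡_ _≡_ g → ∀ v → ∃ λ u → g u ≡ v
injective⇒surjective {n = suc n} {g} g-inj v with any? (λ u → g u ≟ v)
... | yes hit = hit
... | no miss = contradiction (injective⇒≤ punchOut∘g-injective) 1+n≰n
  where
  v≢g : ∀ u → v ≢ g u
  v≢g u v≡gu = miss (u , sym v≡gu)
  punchOut∘g-injective : Injective _≡_ _≡_ (λ u → punchOut (v≢g u))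
  punchOut∘g-injective eq = g-inj (punchOut-injective (v≢g _) (v≢g _) eq)

next : Fin n → Fin n
next {suc n} v with suc (toℕ v) <? suc n
... | yes v+1<n = fromℕ< v+1<n
... | no _      = Fin.zero

next-arc : (v : Fin n) → CycArc n v (next v)
next-arc {suc n} v with suc (toℕ v) <? suc n
... | yes v+1<n = inj₁ (sym (toℕ-fromℕ< v+1<n))
... | no v+1≮n  = inj₂ (≤-antisym (toℕ<n v) (≮⇒≥ v+1≮n) , refl)

m+n≤1+m*n : ∀ {m n} → 1 ≤ m → 1 ≤ n → m + n ≤ suc (m * n)
m+n≤1+m*n {suc m} {suc n} _ _ = s≤s (begin
  m + suc n      ≡⟨ +-suc m n ⟩
  suc (m + n)    ≡⟨ cong suc (+-comm m n) ⟩
  suc (n + m)    ≤⟨ s≤s (+-monoʳ-≤ n (m≤m*n m (suc n))) ⟩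
  suc (n + m * suc n) ∎)
  where open ≤-Reasoning

m≤o∧m*n<o⇒m+n≤o : ∀ {m n o} → 1 ≤ m → m ≤ o → m * n < o → m + n ≤ o
m≤o∧m*n<o⇒m+n≤o {m} {zero}  _   m≤o _     = ≤-trans (≤-reflexive (+-identityʳ m)) m≤o
m≤o∧m*n<o⇒m+n≤o {m} {suc n} 1≤m _   mn<o = ≤-trans (m+n≤1+m*n 1≤m (s≤s z≤n)) mn<o

module Packing {n k p : ℕ} (P : LabeledPacking n k p) where
  open LabeledPacking P

  labelCount≡count : ∀ l → labelCount l ≡ count (λ w → f w ≟ l)
  labelCount≡count l = length-filter-tabulate (λ w → f w ≟ l) id

  σ⁻¹ : Fin k → Fin n → Fin n
  σ⁻¹ i v = proj₁ (injective⇒surjective (σ-inj i) v)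

  σ∘σ⁻¹ : ∀ i v → σ i (σ⁻¹ i v) ≡ v
  σ∘σ⁻¹ i v = proj₂ (injective⇒surjective (σ-inj i) v)

  successor : Fin k → Fin n → Fin n
  successor i v = σ i (next (σ⁻¹ i v))

  successor-≢ : ∀ i v → v ≢ successor i v
  successor-≢ i v v≡succ = σ-arc i _ _ (next-arc (σ⁻¹ i v)) (trans (σ∘σ⁻¹ i v) v≡succ)

  successor-injective : ∀ {i j} v → successor i v ≡ successor j v → i ≡ j
  successor-injective {i} {j} v eq with i ≟ j
  ... | yes i≡j = i≡j
  ... | no i≢j  = contradiction (trans (σ∘σ⁻¹ i v) (sym (σ∘σ⁻¹ j v)) , eq)
                    (disjoint i j i≢j _ _ _ _ (next-arc (σ⁻¹ i v)) (next-arc (σ⁻¹ j v)))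

  neighbourhood : Fin n → Fin (suc k) → Fin n
  neighbourhood v Fin.zero    = v
  neighbourhood v (Fin.suc i) = successor i v

  neighbourhood-injective : ∀ v → Injective _≡_ _≡_ (neighbourhood v)
  neighbourhood-injective v {Fin.zero}  {Fin.zero}  _  = refl
  neighbourhood-injective v {Fin.zero}  {Fin.suc j} eq = contradiction eq (successor-≢ j v)
  neighbourhood-injective v {Fin.suc i} {Fin.zero}  eq = contradiction (sym eq) (successor-≢ i v)
  neighbourhood-injective v {Fin.suc i} {Fin.suc j} eq = cong Fin.suc (successor-injective v eq)

  SuccessorLabel : Fin n → Pred (Fin p) 0ℓ
  SuccessorLabel v l = ∃ λ i → f (successor i v) ≡ l

  successorLabel? : ∀ v → Decidable (SuccessorLabel v)
  successorLabel? v l = any? λ i → f (successor i v) ≟ l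

  SeenLabel : Fin n → Pred (Fin p) 0ℓ
  SeenLabel v = (f v ≡_) ∪ SuccessorLabel v

  seenLabel? : ∀ v → Decidable (SeenLabel v)
  seenLabel? v = (f v ≟_) ∪? successorLabel? v

  seen-vertices : ∀ v → suc k ≤ count (seenLabel? v ∘ f)
  seen-vertices v = begin
    suc k                                   ≡⟨ count-universal all? (λ _ → tt) ⟨
    count all?                              ≤⟨ count-≤-injective all? (seenLabel? v ∘ f)
                                                 (neighbourhood-injective v) (λ {i} _ → seen i) ⟩
    count (seenLabel? v ∘ f)                ∎
    where
    open ≤-Reasoning
    all? : Decidable {A = Fin (suc k)} (λ _ → ⊤)
    all? _ = yes tt
    seen : ∀ i → SeenLabel v (f (neighbourhood v i))
    seen Fin.zero    = inj₁ refl
    seen (Fin.suc i) = inj₂ (i , refl)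

  successor-labels : Fin k → ∀ v → count (successorLabel? v) ≤ labelCount (f v)
  successor-labels i₀ v = begin
    count (successorLabel? v)            ≤⟨ count-≤-surjective (λ t → f (σ i₀ t) ≟ f v) (successorLabel? v)
                                              (λ t → f (σ i₀ (next t))) read-in-copy-i₀ ⟩
    count (λ t → f (σ i₀ t) ≟ f v)       ≤⟨ count-≤-injective _ (λ w → f w ≟ f v) (σ-inj i₀) id ⟩
    count (λ w → f w ≟ f v)              ≡⟨ labelCount≡count (f v) ⟨
    labelCount (f v)                     ∎
    where
    open ≤-Reasoning
    read-in-copy-i₀ : ∀ {l} → SuccessorLabel v l → ∃ λ t → f (σ i₀ t) ≡ f v × f (σ i₀ (next t)) ≡ l
    read-in-copy-i₀ (i , label≡l) =
      σ⁻¹ i v , trans (labels-agree i₀ i _) (cong f (σ∘σ⁻¹ i v)) , trans (labels-agree i₀ i _) label≡l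

  seen-labels : Fin k → ∀ v → count (seenLabel? v) ≤ suc (labelCount (f v))
  seen-labels i₀ v = begin
    count (seenLabel? v)                          ≤⟨ count-∪ (f v ≟_) (successorLabel? v) ⟩
    count (f v ≟_) + count (successorLabel? v)    ≤⟨ +-mono-≤ (≤-reflexive (count-singleton (f v)))
                                                               (successor-labels i₀ v) ⟩
    suc (labelCount (f v))                        ∎
    where open ≤-Reasoning

  unseen-vertices : ∀ {q} → (∀ l → q ≤ labelCount l) → ∀ v →
                    q * count (∁? (seenLabel? v)) ≤ count (∁? (seenLabel? v) ∘ f)
  unseen-vertices min v = *-count-≤-count-preimage (∁? (seenLabel? v)) f
                            λ {l} _ → ≤-trans (min l) (≤-reflexive (labelCount≡count l))

labels-≤ : ∀ {k x p q} (P : LabeledPacking (k + x) k p) → Fin k →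
           LabeledPacking.IsMinLabelCount P q → q ≤ x → p ≤ suc x
labels-≤ {k} {x} {p} {q} P i₀ ((a , labelCount-a≡q) , min) q≤x = begin
  p                                                   ≡⟨ count-∁ (seenLabel? u) ⟨
  count (seenLabel? u) + count (∁? (seenLabel? u))    ≤⟨ +-monoˡ-≤ _ seen-labels-u ⟩
  suc (q + count (∁? (seenLabel? u)))                 ≤⟨ s≤s (m≤o∧m*n<o⇒m+n≤o 1≤q q≤x unseen<x) ⟩
  suc x                                               ∎
  where
  open ≤-Reasoning
  open LabeledPacking P
  open Packing P

  u : Fin (k + x)
  u = proj₁ (f-onto a)

  labelCount-u : labelCount (f u) ≡ q
  labelCount-u = trans (cong labelCount (proj₂ (f-onto a) refl)) labelCount-a≡q

  1≤q : 1 ≤ q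
  1≤q = ≤-trans (count-pos (λ w → f w ≟ f u) refl)
                (≤-reflexive (trans (sym (labelCount≡count (f u))) labelCount-u))

  seen-labels-u : count (seenLabel? u) ≤ suc q
  seen-labels-u = ≤-trans (seen-labels i₀ u) (≤-reflexive (cong suc labelCount-u))

  unseen<x : q * count (∁? (seenLabel? u)) < x
  unseen<x = +-cancelˡ-≤ k _ _ (begin
    k + suc (q * count (∁? (seenLabel? u)))                ≡⟨ +-suc k _ ⟩
    suc k + q * count (∁? (seenLabel? u))                  ≤⟨ +-mono-≤ (seen-vertices u) (unseen-vertices min u) ⟩
    count (seenLabel? u ∘ f) + count (∁? (seenLabel? u ∘ f)) ≡⟨ count-∁ (seenLabel? u ∘ f) ⟩
    k + x                                                  ∎)

mainTheorem12 : (k x : ℕ) → 2 ≤ k → 1 ≤ x → x ≤ k ∸ 1 →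
    ¬ (x ≡ 1 × k + x ≡ 4) → ¬ (x ≡ 1 × k + x ≡ 6) →
    (p : ℕ) (P : LabeledPacking (k + x) k p) (q : ℕ) →
    LabeledPacking.IsMinLabelCount P q → q ≤ x → p ≤ x + 2
mainTheorem12 zero    _ () _ _ _ _ _ _ _ _ _
mainTheorem12 (suc k) x _  _ _ _ _ p P q q-min q≤x =
  ≤-trans (labels-≤ P Fin.zero q-min q≤x) (≤-trans (n≤1+n (suc x)) (≤-reflexive (+-comm 2 x)))
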